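{- For every $\alpha\in\mathcal D$: (i) $\llbracket\alpha^+\rrbracket=\{\alpha\}$; (ii) $\llbracket\alpha^-[x]\rrbracket_{x}=\{[\alpha]\}$.
   Context: Syntax of the $\partial_0\lambda$-calculus with tests: terms $M::=x\mid\lambda x.M\mid MP\mid\bar\tau(V)$, bags $P::=[L_1,\dots,L_k]$, tests $V::=\tau[L_1,\dots,L_k]$ (finite multisets of terms, $k\ge0$); $\varepsilon:=\tau[\,]$ and $V\mid W$ denotes multiset union of tests (so an empty parallel composition is $\varepsilon$). A test-context $C$ is a test with one hole $[\cdot]$ in term position; $C[M]$ replaces the hole by $M$. The model $\mathcal D$. $\mathcal M_f(S)$ = finite multisets over $S$. $D_0=\emptyset$, $D_{n+1}$ = $\mathbb N$-indexed sequences $(a_1,a_2,\dots)$ of elements of $\mathcal M_f(D_n)$ with all but finitely many empty; $\mathcal D=\bigcup_nD_n$; $a::(a_1,a_2,\dots):=(a,a_1,a_2,\dots)$; $*:=([\,],[\,],\dots)$; $\uplus$ on tuples is componentwise. For a repetition-free list $\vec x=x_1,\dots,x_n$ containing the free variables: $\llbracket x_i\rrbracket_{\vec x}=\{(([\,],\dots,[\alpha],\dots,[\,]),\alpha):\alpha\in\mathcal D\}$ ($[\alpha]$ in position $i$); $\llbracket\lambda y.M\rrbracket_{\vec x}=\{(\vec a,b::\alpha):((\vec a,b),\alpha)\in\llbracket M\rrbracket_{\vec x,y}\}$; $\llbracket MP\rrbracket_{\vec x}=\{(\vec a_1\uplus\vec a_2,\alpha):\exists b\,(\vec a_1,b::\alpha)\in\llbracket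 M\rrbracket_{\vec x},(\vec a_2,b)\in\llbracket P\rrbracket_{\vec x}\}$; $\llbracket\bar\tau(V)\rrbracket_{\vec x}=\{(\vec a,*):\vec a\in\llbracket V\rrbracket_{\vec x}\}$; $\llbracket[L_1,\dots,L_k]\rrbracket_{\vec x}=\{(\biguplus_i\vec a_i,[\beta_1,\dots,\beta_k]):(\vec a_i,\beta_i)\in\llbracket L_i\rrbracket_{\vec x}\}$; $\llbracket\tau[L_1,\dots,L_k]\rrbracket_{\vec x}=\{\biguplus_i\vec a_i:(\vec a_i,*)\in\llbracket L_i\rrbracket_{\vec x}\}$. For a closed term $M$ (empty list), $\llbracket M\rrbracket$ is regarded as a subset of $\mathcal D$; $\llbracket M\rrbracket_x\subseteq\mathcal M_f(\mathcal D)\times\mathcal D$ and $\llbracket V\rrbracket_x\subseteq\mathcal M_f(\mathcal D)$. Terms $\alpha^+$ and test-contexts $\alpha^-$. The length $\ell(\alpha)$ is $0$ if $\alpha=*$, and otherwise the unique $r$ with $\alpha=a_1::\cdots::a_r::*$ and $a_r\ne[\,]$. For $\alpha=[\alpha_{1,1},\dots,\alpha_{1,k_1}]::\cdots::[\alpha_{r,1},\dots,\alpha_{r,k_r}]::*$ with $r=\ell(\alpha)$, define by mutual induction (well-founded since the $\alpha_{i,j}$ lie in a strictly lower $D_n$): $\alpha^+=\lambda x_1\dots x_r.\bar\tau\big(\,\|_{i=1}^{r}(\alpha_{i,1}^-[x_i]\mid\cdots\mid\alpha_{i,k_i}^-[x_i])\big)$ (a closed term) and $\alpha^-[\cdot]=\tau\big[[\cdot][\alpha_{1,1}^+,\dots,\alpha_{1,k_1}^+]\cdots[\alpha_{r,1}^+,\dots,\alpha_{r,k_r}^+]\big]$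 (a test-context), where $\|_{i=1}^r$ is iterated parallel composition $\mid$. -}

module Defs where

open import Data.Nat using (ℕ; zero; suc; _+_)
open import Data.Nat.Properties using (+-comm)
open import Data.Fin using (Fin; _↑ʳ_; cast) renaming (zero to fzero)
open import Data.List using (List; []; _∷_; _++_; map; allFin)
open import Data.Vec using (Vec; replicate; zipWith; _∷ʳ_; _[_]≔_)
open import Data.Vec.Relation.Binary.Pointwise.Inductive using (Pointwise)
open import Data.List.Relation.Binary.Permutation.Homogeneous using (Permutation)
open import Data.Product using (Σ; ∃; ∃-syntax; _×_; _,_)

-- An element of 𝒟 is a sequence (a₁, a₂, …) of finite multisets of
-- elements of 𝒟, almost all empty.  We represent it by the finite list
-- of its first components, mk [a₁,…,aₖ] = (a₁,…,aₖ,[],[],…); a finite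
-- multiset is represented by a list.  Equality in 𝒟 is the equivalence
-- _≈D_ below: multisets are compared up to permutation (and _≈D_ on
-- elements), sequences are compared componentwise up to trailing empty
-- multisets.  (𝒟 = ⋃ Dₙ is exactly the well-founded/inductive part.)

data D : Set where
  mk : List (List D) → D

MD : Set
MD = List D

mutual
  data _≈D_ : D → D → Set where
    mk≈ : ∀ {as bs} → as ≈S bs → mk as ≈D mk bs

  _≈M_ : MD → MD → Set
  a ≈M b = Permutation _≈D_ a b

  data _≈S_ : List MD → List MD → Set where
    []≈   : [] ≈S []
    _∷≈_  : ∀ {a b as bs} → a ≈M b → as ≈S bs → (a ∷ as) ≈S (b ∷ bs)
    padˡ  : ∀ {as} → as ≈S [] → ([] ∷ as) ≈S []
    padʳ  : ∀ {bs} → [] ≈S bs → [] ≈S ([] ∷ bs)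

⋆ : D
⋆ = mk []

_∷D_ : MD → D → D
a ∷D mk as = mk (a ∷ as)

-- length ℓ(α): number of components up to the last non-empty one
step : MD → ℕ → ℕ
step []      zero    = zero
step (_ ∷ _) zero    = suc zero
step _       (suc k) = suc (suc k)

lenS : List MD → ℕ
lenS []       = zero
lenS (a ∷ as) = step a (lenS as)

ℓ : D → ℕ
ℓ (mk as) = lenS as

-- Syntax of the ∂₀λ-calculus with tests, well-scoped with de Bruijn
-- *levels*: Term n has free variables x₀,…,x_{n-1} (Fin n), and the
-- variable bound by lam is the *last* one (index n), matching
-- ⟦λy.M⟧_{x⃗} = … ⟦M⟧_{x⃗,y}.
-- Bags and tests are finite multisets of terms, represented by lists;
-- tbar ts is τ̄(τ[ts]).

data Term (n : ℕ) : Set where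
  var  : Fin n → Term n
  lam  : Term (suc n) → Term n
  app  : Term n → List (Term n) → Term n
  tbar : List (Term n) → Term n

Bag : ℕ → Set
Bag n = List (Term n)

-- a test τ[L₁,…,Lₖ] is given by its list of terms; V ∣ W is _++_,
-- ε is [].
Test : ℕ → Set
Test n = List (Term n)

Env : ℕ → Set
Env n = Vec MD n

_≈E_ : ∀ {n} → Env n → Env n → Set
_≈E_ = Pointwise _≈M_

_⊎E_ : ∀ {n} → Env n → Env n → Env n
_⊎E_ = zipWith _++_

emptyE : ∀ {n} → Env n
emptyE {n} = replicate n []

unitE : ∀ {n} → Fin n → D → Env n
unitE i α = emptyE [ i ]≔ (α ∷ [])

mutual
  ⟦_⟧ : ∀ {n} → Term n → Env n → D → Set
  ⟦ var i ⟧  ρ α = ρ ≈E unitE i α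
  ⟦ lam M ⟧  ρ α = ∃[ b ] ∃[ α' ] (α ≈D (b ∷D α') × ⟦ M ⟧ (ρ ∷ʳ b) α')
  ⟦ app M P ⟧ ρ α = ∃[ ρ₁ ] ∃[ ρ₂ ] ∃[ b ]
                     (ρ ≈E (ρ₁ ⊎E ρ₂) × ⟦ M ⟧ ρ₁ (b ∷D α) × ⟦ P ⟧B ρ₂ b)
  ⟦ tbar V ⟧ ρ α = α ≈D ⋆ × ⟦ V ⟧T ρ

  ⟦_⟧B : ∀ {n} → Bag n → Env n → MD → Set
  ⟦ [] ⟧B     ρ b = ρ ≈E emptyE × b ≈M []
  ⟦ L ∷ Ls ⟧B ρ b = ∃[ ρ₁ ] ∃[ ρ₂ ] ∃[ β ] ∃[ b' ]
                     (ρ ≈E (ρ₁ ⊎E ρ₂) × b ≈M (β ∷ b') × ⟦ L ⟧ ρ₁ β × ⟦ Ls ⟧B ρ₂ b')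

  ⟦_⟧T : ∀ {n} → Test n → Env n → Set
  ⟦ [] ⟧T     ρ = ρ ≈E emptyE
  ⟦ L ∷ Ls ⟧T ρ = ∃[ ρ₁ ] ∃[ ρ₂ ] (ρ ≈E (ρ₁ ⊎E ρ₂) × ⟦ L ⟧ ρ₁ ⋆ × ⟦ Ls ⟧T ρ₂)

-- α⁺ and α⁻.  α⁺ is closed; plus α n is α⁺ regarded as a term with n
-- (unused) free variables, so that it can be plugged into contexts.
-- minus α M is the test α⁻[M].

lams : ∀ n r → Term (r + n) → Term n
lams n zero    t = t
lams n (suc r) t = lams n r (lam t)

-- the variables x₁,…,x_r bound by lams n r, as indices in scope r + n
boundVars : ∀ n r → List (Fin (r + n))
boundVars n r = map (λ i → cast (+-comm n r) (n ↑ʳ i)) (allFin r)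

mutual
  plus : D → (n : ℕ) → Term n
  plus (mk as) n = lams n (lenS as) (tbar (body as (boundVars n (lenS as))))

  -- ∥ᵢ (α_{i,1}⁻[xᵢ] ∣ ⋯ ∣ α_{i,kᵢ}⁻[xᵢ])   (components beyond ℓ(α) are empty)
  body : ∀ {m} → List MD → List (Fin m) → Test m
  body []       _        = []
  body (_ ∷ _)  []       = []
  body (a ∷ as) (x ∷ xs) = comp a x ++ body as xs

  comp : ∀ {m} → MD → Fin m → Test m
  comp []      x = []
  comp (α ∷ β) x = minus α (var x) ++ comp β x

  -- α⁻[M] = τ[ M [α_{1,*}⁺] ⋯ [α_{r,*}⁺] ],  r = ℓ(α)
  minus : ∀ {m} → D → Term m → Test m
  minus (mk as) M = apps M as (lenS as) ∷ []

  apps : ∀ {m} → Term m → List MD → ℕ → Term m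
  apps M []       _       = M
  apps M (_ ∷ _)  zero    = M
  apps M (a ∷ as) (suc k) = apps (app M (plusBag a)) as k

  plusBag : ∀ {m} → MD → Bag m
  plusBag []      = []
  plusBag (α ∷ β) = plus α _ ∷ plusBag β

_⁺ : D → Term 0
α ⁺ = plus α 0

_⁻[x] : D → Test 1
α ⁻[x] = minus α (var fzero)

-- Everything is proved by one simultaneous induction on α, for α⁺ under any
-- number of (unused) free variables and for α⁻[x] at any variable x, each
-- piece of syntax being characterised up to ≈ by an equivalence.  A bag
-- [α₁⁺,…,α_k⁺] denotes exactly [α₁,…,α_k] in the empty environment, so
-- applying a term to the bags of α⁻ prepends the components of α to its
-- result, and the test α⁻[x] holds exactly when x is assigned [α].  Hence the
-- body of α⁺ = λx₁…x_r.τ̄(…) holds exactly in the environment assigning the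
-- i-th component of α to xᵢ, and the abstraction returns a₁::⋯::a_r::* ≈ α,
-- because r = ℓ(α) only drops trailing empty components.  The one piece of
-- genuine bookkeeping is matching that environment, built with de Bruijn
-- levels, against the environment the abstractions extend.

module Submission where

open import Defs
open import Data.Vec using ([]; _∷_)
open import Data.List using ([]; _∷_)
open import Data.Product using (_×_)
open import Function.Bundles using (_⇔_)

open import Data.Bool using (if_then_else_)
open import Data.Fin using (Fin; toℕ; cast; _↑ʳ_) renaming (zero to fzero; suc to fsuc)
open import Data.Fin.Properties using (toℕ-cast; toℕ-↑ʳ)
open import Data.List using (List; _++_; map; take; foldr; tabulate)
import Data.List as List
open import Data.List.Properties
  using (++-assoc; ++-identityˡ; ++-identityʳ; foldr-++; map-tabulate; tabulate-cong)
import Data.List.Relation.Binary.Pointwise.Base as ListPw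
open import Data.List.Relation.Binary.Permutation.Homogeneous using (refl; prep; swap; trans)
open import Data.Nat using (ℕ; zero; suc; _+_; _≡ᵇ_)
open import Data.Nat.Properties using (+-comm; +-suc)
open import Data.Product using (∃-syntax; _,_; proj₂)
open import Data.Vec using (toList; _∷ʳ_; _[_]≔_)
open import Data.Vec.Properties
  using ( toList-∷ʳ; toList-replicate; []≔-lookup; lookup-replicate
        ; zipWith-assoc; zipWith-identityˡ; zipWith-identityʳ)
import Data.Vec.Relation.Binary.Pointwise.Inductive as VecPw
open import Function.Bundles using (Equivalence; mk⇔)
open import Function.Construct.Identity using (⇔-id)
open import Function.Properties.Equivalence using () renaming (trans to ⇔-trans)
open import Relation.Binary.Bundles using (Setoid)
open import Relation.Binary.Definitions using (Reflexive; Symmetric; Transitive)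
open import Relation.Binary.PropositionalEquality as ≡ using (_≡_; cong; cong₂; subst; subst₂)

open Equivalence using (to; from)

mutual
  ≈D-refl : Reflexive _≈D_
  ≈D-refl {mk as} = mk≈ ≈S-refl

  ≈S-refl : Reflexive _≈S_
  ≈S-refl {[]}     = []≈
  ≈S-refl {a ∷ as} = ≈M-refl ∷≈ ≈S-refl

  ≈M-refl : Reflexive _≈M_
  ≈M-refl = refl ≋D-refl

  ≋D-refl : Reflexive (ListPw.Pointwise _≈D_)
  ≋D-refl {[]}    = ListPw.[]
  ≋D-refl {x ∷ a} = ≈D-refl ListPw.∷ ≋D-refl

mutual
  ≈D-sym : Symmetric _≈D_
  ≈D-sym (mk≈ p) = mk≈ (≈S-sym p)

  ≈S-sym : Symmetric _≈S_
  ≈S-sym []≈       = []≈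
  ≈S-sym (p ∷≈ ps) = ≈M-sym p ∷≈ ≈S-sym ps
  ≈S-sym (padˡ p)  = padʳ (≈S-sym p)
  ≈S-sym (padʳ p)  = padˡ (≈S-sym p)

  ≈M-sym : Symmetric _≈M_
  ≈M-sym (refl ps)      = refl (≋D-sym ps)
  ≈M-sym (prep e p)     = prep (≈D-sym e) (≈M-sym p)
  ≈M-sym (swap e₁ e₂ p) = swap (≈D-sym e₂) (≈D-sym e₁) (≈M-sym p)
  ≈M-sym (trans p q)    = trans (≈M-sym q) (≈M-sym p)

  ≋D-sym : Symmetric (ListPw.Pointwise _≈D_)
  ≋D-sym ListPw.[]       = ListPw.[]
  ≋D-sym (e ListPw.∷ es) = ≈D-sym e ListPw.∷ ≋D-sym es

≈M-[]⇒≡[] : ∀ {a} → a ≈M [] → a ≡ []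
≈M-[]⇒≡[] (refl ListPw.[]) = ≡.refl
≈M-[]⇒≡[] (trans p q) with ≈M-[]⇒≡[] q
... | ≡.refl = ≈M-[]⇒≡[] p

≈S-trans : Transitive _≈S_
≈S-trans []≈       q         = q
≈S-trans (p ∷≈ ps) (q ∷≈ qs) = trans p q ∷≈ ≈S-trans ps qs
≈S-trans (p ∷≈ ps) (padˡ q) with ≈M-[]⇒≡[] p
... | ≡.refl = padˡ (≈S-trans ps q)
≈S-trans (padˡ p)  []≈       = padˡ p
≈S-trans (padˡ p)  (padʳ q)  = ≈M-refl ∷≈ ≈S-trans p q
≈S-trans (padʳ p)  (q ∷≈ qs) with ≈M-[]⇒≡[] (≈M-sym q)
... | ≡.refl = padʳ (≈S-trans p qs)
≈S-trans (padʳ p)  (padˡ q)  = []≈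

≈D-trans : Transitive _≈D_
≈D-trans (mk≈ p) (mk≈ q) = mk≈ (≈S-trans p q)

𝒟-setoid : Setoid _ _
𝒟-setoid = record
  { Carrier       = D
  ; _≈_           = _≈D_
  ; isEquivalence = record { refl = ≈D-refl ; sym = ≈D-sym ; trans = ≈D-trans }
  }

open import Data.List.Relation.Binary.Permutation.Setoid 𝒟-setoid using (↭-setoid)
open import Data.List.Relation.Binary.Permutation.Setoid.Properties 𝒟-setoid using (++⁺)

∷D-cong : ∀ {a b γ δ} → a ≈M b → γ ≈D δ → (a ∷D γ) ≈D (b ∷D δ)
∷D-cong a≈b (mk≈ p) = mk≈ (a≈b ∷≈ p)

Env-setoid : ℕ → Setoid _ _
Env-setoid = VecPw.setoid ↭-setoid

module _ {n : ℕ} where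
  open Setoid (Env-setoid n) public
    using () renaming (refl to ≈E-refl; sym to ≈E-sym; trans to ≈E-trans; reflexive to ≈E-reflexive)

⊎E-cong : ∀ {n} {ρ ρ′ σ σ′ : Env n} → ρ ≈E ρ′ → σ ≈E σ′ → (ρ ⊎E σ) ≈E (ρ′ ⊎E σ′)
⊎E-cong = VecPw.zipWith-cong ++⁺

⊎E-assoc : ∀ {n} (ρ σ τ : Env n) → ((ρ ⊎E σ) ⊎E τ) ≡ (ρ ⊎E (σ ⊎E τ))
⊎E-assoc = zipWith-assoc ++-assoc

⊎E-identityˡ : ∀ {n} (ρ : Env n) → (emptyE ⊎E ρ) ≡ ρ
⊎E-identityˡ = zipWith-identityˡ ++-identityˡ

⊎E-identityʳ : ∀ {n} (ρ : Env n) → (ρ ⊎E emptyE) ≡ ρ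
⊎E-identityʳ = zipWith-identityʳ ++-identityʳ

⊎E-emptyʳ : ∀ {n} {ρ σ : Env n} → σ ≈E emptyE → (ρ ⊎E σ) ≈E ρ
⊎E-emptyʳ {ρ = ρ} σ≈∅ = ≈E-trans (⊎E-cong ≈E-refl σ≈∅) (≈E-reflexive (⊎E-identityʳ ρ))

≈E-⇔ʳ : ∀ {n} {ρ σ τ : Env n} → σ ≈E τ → (ρ ≈E σ) ⇔ (ρ ≈E τ)
≈E-⇔ʳ σ≈τ = mk⇔ (λ e → ≈E-trans e σ≈τ) (λ e → ≈E-trans e (≈E-sym σ≈τ))

∷ʳ-≈E : ∀ {n} {ρ σ : Env n} {a b} → (ρ ∷ʳ a) ≈E (σ ∷ʳ b) ⇔ (ρ ≈E σ × a ≈M b)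
∷ʳ-≈E = mk⇔ split join
  where
  split : ∀ {n} {ρ σ : Env n} {a b} → (ρ ∷ʳ a) ≈E (σ ∷ʳ b) → ρ ≈E σ × a ≈M b
  split {ρ = []}    {[]}    (a≈b VecPw.∷ VecPw.[]) = VecPw.[] , a≈b
  split {ρ = _ ∷ _} {_ ∷ _} (c≈d VecPw.∷ e) with split e
  ... | ρ≈σ , a≈b = c≈d VecPw.∷ ρ≈σ , a≈b

  join : ∀ {n} {ρ σ : Env n} {a b} → ρ ≈E σ × a ≈M b → (ρ ∷ʳ a) ≈E (σ ∷ʳ b)
  join (VecPw.[] , a≈b)          = a≈b VecPw.∷ VecPw.[]
  join (c≈d VecPw.∷ ρ≈σ , a≈b) = c≈d VecPw.∷ join (ρ≈σ , a≈b)

[]≔-congʳ : ∀ {n} (ρ : Env n) (i : Fin n) {a b} → a ≈M b → (ρ [ i ]≔ a) ≈E (ρ [ i ]≔ b)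
[]≔-congʳ (_ ∷ ρ) fzero    a≈b = a≈b VecPw.∷ ≈E-refl
[]≔-congʳ (_ ∷ ρ) (fsuc i) a≈b = ≈M-refl VecPw.∷ []≔-congʳ ρ i a≈b

unitE-cong : ∀ {n} (i : Fin n) {α β} → α ≈D β → unitE i α ≈E unitE i β
unitE-cong i α≈β = []≔-congʳ emptyE i (prep α≈β ≈M-refl)

emptyE-[]≔-[] : ∀ {n} (i : Fin n) → (emptyE [ i ]≔ []) ≡ emptyE
emptyE-[]≔-[] i = ≡.trans (cong (emptyE [ i ]≔_) (≡.sym (lookup-replicate i []))) ([]≔-lookup emptyE i)

emptyE-[]≔-⊎E : ∀ {n} (i : Fin n) a b → ((emptyE [ i ]≔ a) ⊎E (emptyE [ i ]≔ b)) ≡ (emptyE [ i ]≔ (a ++ b))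
emptyE-[]≔-⊎E {suc n} fzero a b = cong ((a ++ b) ∷_) (zipWith-identityʳ ++-identityʳ (emptyE {n}))
emptyE-[]≔-⊎E (fsuc i) a b = cong ([] ∷_) (emptyE-[]≔-⊎E i a b)

⟦⟧T-resp : ∀ {m} (V : Test m) {ρ ρ′} → ρ ≈E ρ′ → ⟦ V ⟧T ρ → ⟦ V ⟧T ρ′
⟦⟧T-resp []      ρ≈ h                       = ≈E-trans (≈E-sym ρ≈) h
⟦⟧T-resp (_ ∷ _) ρ≈ (ρ₁ , ρ₂ , e , hL , hV) = ρ₁ , ρ₂ , ≈E-trans (≈E-sym ρ≈) e , hL , hV

⟦⟧-resp : ∀ {m} (M : Term m) {ρ ρ′ α β} → ρ ≈E ρ′ → α ≈D β → ⟦ M ⟧ ρ α → ⟦ M ⟧ ρ′ β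
⟦⟧-resp (var i)   ρ≈ α≈ h = ≈E-trans (≈E-sym ρ≈) (≈E-trans h (unitE-cong i α≈))
⟦⟧-resp (lam M)   ρ≈ α≈ (b , α′ , e , h) =
  b , α′ , ≈D-trans (≈D-sym α≈) e , ⟦⟧-resp M (from ∷ʳ-≈E (ρ≈ , ≈M-refl)) ≈D-refl h
⟦⟧-resp (app M P) ρ≈ α≈ (ρ₁ , ρ₂ , b , e , hM , hP) =
  ρ₁ , ρ₂ , b , ≈E-trans (≈E-sym ρ≈) e , ⟦⟧-resp M ≈E-refl (∷D-cong ≈M-refl α≈) hM , hP
⟦⟧-resp (tbar V)  ρ≈ α≈ (e , h) = ≈D-trans (≈D-sym α≈) e , ⟦⟧T-resp V ρ≈ h

⟦[_]⟧T : ∀ {m} (L : Term m) {ρ} → ⟦ L ∷ [] ⟧T ρ ⇔ ⟦ L ⟧ ρ ⋆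
⟦[ L ]⟧T {ρ} = mk⇔
  (λ (ρ₁ , ρ₂ , e , h , ρ₂≈∅) → ⟦⟧-resp L (≈E-sym (≈E-trans e (⊎E-emptyʳ ρ₂≈∅))) ≈D-refl h)
  (λ h → ρ , emptyE , ≈E-sym (⊎E-emptyʳ ≈E-refl) , h , ≈E-refl)

⟦++⟧T⁻ : ∀ {m} (V W : Test m) {ρ} → ⟦ V ++ W ⟧T ρ →
  ∃[ ρ₁ ] ∃[ ρ₂ ] (ρ ≈E (ρ₁ ⊎E ρ₂) × ⟦ V ⟧T ρ₁ × ⟦ W ⟧T ρ₂)
⟦++⟧T⁻ []      W {ρ} h = emptyE , ρ , ≈E-sym (≈E-reflexive (⊎E-identityˡ ρ)) , ≈E-refl , h
⟦++⟧T⁻ (L ∷ V) W (σ₁ , σ₂ , e , hL , h) with ⟦++⟧T⁻ V W h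
... | τ₁ , τ₂ , e′ , hV , hW =
  σ₁ ⊎E τ₁ , τ₂ ,
  ≈E-trans e (≈E-trans (⊎E-cong ≈E-refl e′) (≈E-reflexive (≡.sym (⊎E-assoc σ₁ τ₁ τ₂)))) ,
  (σ₁ , τ₁ , ≈E-refl , hL , hV) , hW

⟦++⟧T⁺ : ∀ {m} (V W : Test m) {ρ ρ₁ ρ₂} → ρ ≈E (ρ₁ ⊎E ρ₂) → ⟦ V ⟧T ρ₁ → ⟦ W ⟧T ρ₂ → ⟦ V ++ W ⟧T ρ
⟦++⟧T⁺ []      W {ρ₂ = ρ₂} e ρ₁≈∅ hW =
  ⟦⟧T-resp W (≈E-sym (≈E-trans e (≈E-trans (⊎E-cong ρ₁≈∅ ≈E-refl) (≈E-reflexive (⊎E-identityˡ ρ₂))))) hW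
⟦++⟧T⁺ (L ∷ V) W {ρ₂ = ρ₂} e (σ₁ , σ₂ , e₁ , hL , hV) hW =
  σ₁ , σ₂ ⊎E ρ₂ ,
  ≈E-trans e (≈E-trans (⊎E-cong e₁ ≈E-refl) (≈E-reflexive (⊎E-assoc σ₁ σ₂ ρ₂))) ,
  hL , ⟦++⟧T⁺ V W ≈E-refl hV hW

⟦++⟧T-≈E : ∀ {m} (V W : Test m) {σ τ : Env m} →
  (∀ {ρ} → ⟦ V ⟧T ρ ⇔ ρ ≈E σ) → (∀ {ρ} → ⟦ W ⟧T ρ ⇔ ρ ≈E τ) →
  ∀ {ρ} → ⟦ V ++ W ⟧T ρ ⇔ ρ ≈E (σ ⊎E τ)
⟦++⟧T-≈E V W ⟦V⟧ ⟦W⟧ = mk⇔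
  (λ h → let (ρ₁ , ρ₂ , e , hV , hW) = ⟦++⟧T⁻ V W h in ≈E-trans e (⊎E-cong (to ⟦V⟧ hV) (to ⟦W⟧ hW)))
  (λ e → ⟦++⟧T⁺ V W e (from ⟦V⟧ ≈E-refl) (from ⟦W⟧ ≈E-refl))

-- Values of the variables bound by lams n r; the innermost binder comes last.

data Snoc : ℕ → Set where
  ◇   : Snoc 0
  _▷_ : ∀ {r} → Snoc r → MD → Snoc (suc r)

toListˢ : ∀ {r} → Snoc r → List MD
toListˢ ◇        = []
toListˢ (bs ▷ b) = toListˢ bs ++ b ∷ []

infixl 25 _⊕_

_⊕_ : ∀ {n r} → Env n → Snoc r → Env (r + n)
ρ ⊕ ◇        = ρ
ρ ⊕ (bs ▷ b) = (ρ ⊕ bs) ∷ʳ b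

data _≋_ : ∀ {r} → Snoc r → Snoc r → Set where
  ◇   : ◇ ≋ ◇
  _▷_ : ∀ {r} {bs cs : Snoc r} {b c} → bs ≋ cs → b ≈M c → (bs ▷ b) ≋ (cs ▷ c)

≋-refl : ∀ {r} {bs : Snoc r} → bs ≋ bs
≋-refl {bs = ◇}      = ◇
≋-refl {bs = bs ▷ b} = ≋-refl ▷ ≈M-refl

⊕-≈E : ∀ {n r} {ρ σ : Env n} (bs cs : Snoc r) → (ρ ⊕ bs) ≈E (σ ⊕ cs) ⇔ (ρ ≈E σ × bs ≋ cs)
⊕-≈E ◇        ◇        = mk⇔ (_, ◇) (λ (ρ≈σ , _) → ρ≈σ)
⊕-≈E (bs ▷ b) (cs ▷ c) = mk⇔
  (λ e → let (e′ , b≈c) = to ∷ʳ-≈E e ; (ρ≈σ , bs≋cs) = to (⊕-≈E bs cs) e′ in ρ≈σ , bs≋cs ▷ b≈c)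
  (λ { (ρ≈σ , bs≋cs ▷ b≈c) → from ∷ʳ-≈E (from (⊕-≈E bs cs) (ρ≈σ , bs≋cs) , b≈c) })

prefix : List MD → D → D
prefix as γ = foldr _∷D_ γ as

prefix-∷ʳ : ∀ as b γ → prefix (as ++ b ∷ []) γ ≡ prefix as (b ∷D γ)
prefix-∷ʳ as b γ = foldr-++ _∷D_ γ as (b ∷ [])

prefix-mk : ∀ as cs → prefix as (mk cs) ≡ mk (as ++ cs)
prefix-mk []       cs = ≡.refl
prefix-mk (a ∷ as) cs = cong (a ∷D_) (prefix-mk as cs)

prefix-≋ : ∀ {r} {bs cs : Snoc r} {γ δ} → bs ≋ cs → γ ≈D δ →
  prefix (toListˢ bs) γ ≈D prefix (toListˢ cs) δ
prefix-≋ ◇ γ≈δ = γ≈δ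
prefix-≋ {bs = bs ▷ b} {cs ▷ c} {γ} {δ} (bs≋cs ▷ b≈c) γ≈δ =
  subst₂ _≈D_ (≡.sym (prefix-∷ʳ (toListˢ bs) b γ)) (≡.sym (prefix-∷ʳ (toListˢ cs) c δ))
    (prefix-≋ bs≋cs (∷D-cong b≈c γ≈δ))

⟦lams⟧ : ∀ {n} r (t : Term (r + n)) {ρ : Env n} {β} →
  ⟦ lams n r t ⟧ ρ β ⇔ (∃[ bs ] ∃[ γ ] (β ≈D prefix (toListˢ bs) γ × ⟦ t ⟧ (ρ ⊕ bs) γ))
⟦lams⟧ zero    t = mk⇔ (λ h → ◇ , _ , ≈D-refl , h) (λ { (◇ , _ , β≈ , h) → ⟦⟧-resp t ≈E-refl (≈D-sym β≈) h })
⟦lams⟧ (suc r) t {ρ} {β} = mk⇔ bind unbind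
  where
  bind : ⟦ lams _ r (lam t) ⟧ ρ β → ∃[ bs ] ∃[ γ ] (β ≈D prefix (toListˢ bs) γ × ⟦ t ⟧ (ρ ⊕ bs) γ)
  bind h with to (⟦lams⟧ r (lam t)) h
  ... | bs , γ , β≈ , b , γ′ , γ≈ , ht =
    bs ▷ b , γ′ ,
    ≈D-trans β≈ (subst (_ ≈D_) (≡.sym (prefix-∷ʳ (toListˢ bs) b γ′)) (prefix-≋ (≋-refl {bs = bs}) γ≈)) , ht

  unbind : ∃[ bs ] ∃[ γ ] (β ≈D prefix (toListˢ bs) γ × ⟦ t ⟧ (ρ ⊕ bs) γ) → ⟦ lams _ r (lam t) ⟧ ρ β
  unbind (bs ▷ b , γ , β≈ , ht) =
    from (⟦lams⟧ r (lam t)) (bs , b ∷D γ , subst (β ≈D_) (prefix-∷ʳ (toListˢ bs) b γ) β≈ , b , γ , ≈D-refl , ht)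

-- Index bookkeeping for the variables bound by α⁺

assign : ∀ {m} → List MD → List (Fin m) → Env m
assign []       _        = emptyE
assign (_ ∷ _)  []       = emptyE
assign (a ∷ as) (x ∷ xs) = (emptyE [ x ]≔ a) ⊎E assign as xs

component : List MD → ℕ → MD
component []       _       = []
component (a ∷ _)  zero    = a
component (_ ∷ as) (suc k) = component as k

at : ∀ {n} → Env n → ℕ → MD
at ρ = component (toList ρ)

at-injective : ∀ {n} (ρ σ : Env n) → (∀ k → at ρ k ≡ at σ k) → ρ ≡ σ
at-injective []      []      _ = ≡.refl
at-injective (a ∷ ρ) (b ∷ σ) h = cong₂ _∷_ (h zero) (at-injective ρ σ (λ k → h (suc k)))

at-emptyE : ∀ n k → at (emptyE {n}) k ≡ []
at-emptyE zero    k       = ≡.refl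
at-emptyE (suc n) zero    = ≡.refl
at-emptyE (suc n) (suc k) = at-emptyE n k

at-⊎E : ∀ {n} (ρ σ : Env n) k → at (ρ ⊎E σ) k ≡ at ρ k ++ at σ k
at-⊎E []      []      k       = ≡.refl
at-⊎E (a ∷ ρ) (b ∷ σ) zero    = ≡.refl
at-⊎E (a ∷ ρ) (b ∷ σ) (suc k) = at-⊎E ρ σ k

at-[]≔ : ∀ {n} (i : Fin n) a k → at (emptyE [ i ]≔ a) k ≡ (if toℕ i ≡ᵇ k then a else [])
at-[]≔         fzero    a zero    = ≡.refl
at-[]≔ {suc n} fzero    a (suc k) = at-emptyE n k
at-[]≔         (fsuc i) a zero    = ≡.refl
at-[]≔         (fsuc i) a (suc k) = at-[]≔ i a k

-- the k-th component of the sequence carrying aᵢ at position jᵢ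
spread : List MD → List ℕ → ℕ → MD
spread []       _        _ = []
spread (_ ∷ _)  []       _ = []
spread (a ∷ as) (j ∷ js) k = (if j ≡ᵇ k then a else []) ++ spread as js k

at-assign : ∀ {m} as (xs : List (Fin m)) k → at (assign as xs) k ≡ spread as (map toℕ xs) k
at-assign {m} []       xs       k = at-emptyE m k
at-assign {m} (a ∷ as) []       k = at-emptyE m k
at-assign     (a ∷ as) (x ∷ xs) k =
  ≡.trans (at-⊎E (emptyE [ x ]≔ a) (assign as xs) k) (cong₂ _++_ (at-[]≔ x a k) (at-assign as xs k))

range : ℕ → ℕ → List ℕ
range n zero    = []
range n (suc r) = n ∷ range (suc n) r

tabulate-range : ∀ n r → tabulate {n = r} (λ i → n + toℕ i) ≡ range n r
tabulate-range n zero    = ≡.refl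
tabulate-range n (suc r) =
  cong₂ _∷_ (+-comm n 0) (≡.trans (tabulate-cong (λ i → +-suc n (toℕ i))) (tabulate-range (suc n) r))

boundVars-range : ∀ n r → map toℕ (boundVars n r) ≡ range n r
boundVars-range n r = begin
  map toℕ (map bound (tabulate (λ i → i))) ≡⟨ cong (map toℕ) (map-tabulate (λ i → i) bound) ⟩
  map toℕ (tabulate bound)                 ≡⟨ map-tabulate bound toℕ ⟩
  tabulate (λ i → toℕ (bound i))           ≡⟨ tabulate-cong (λ i → ≡.trans (toℕ-cast _ (n ↑ʳ i)) (toℕ-↑ʳ n i)) ⟩
  tabulate (λ i → n + toℕ i)               ≡⟨ tabulate-range n r ⟩
  range n r                                ∎
  where
  open ≡.≡-Reasoning
  bound : Fin r → Fin (r + n)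
  bound i = cast (+-comm n r) (n ↑ʳ i)

padTake : ℕ → List MD → List MD
padTake zero    _        = []
padTake (suc r) []       = [] ∷ padTake r []
padTake (suc r) (a ∷ as) = a ∷ padTake r as

component-padTake-[] : ∀ r k → component (padTake r []) k ≡ []
component-padTake-[] zero    k       = ≡.refl
component-padTake-[] (suc r) zero    = ≡.refl
component-padTake-[] (suc r) (suc k) = component-padTake-[] r k

spread-range-zero : ∀ as n r → spread as (range (suc n) r) zero ≡ []
spread-range-zero []       n zero    = ≡.refl
spread-range-zero []       n (suc r) = ≡.refl
spread-range-zero (a ∷ as) n zero    = ≡.refl
spread-range-zero (a ∷ as) n (suc r) = spread-range-zero as (suc n) r

spread-range-suc : ∀ as n r k → spread as (range (suc n) r) (suc k) ≡ spread as (range n r) k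
spread-range-suc []       n zero    k = ≡.refl
spread-range-suc []       n (suc r) k = ≡.refl
spread-range-suc (a ∷ as) n zero    k = ≡.refl
spread-range-suc (a ∷ as) n (suc r) k = cong ((if n ≡ᵇ k then a else []) ++_) (spread-range-suc as (suc n) r k)

spread-range : ∀ as n r k → spread as (range n r) k ≡ component (List.replicate n [] ++ padTake r as) k
spread-range []       zero    r       k       = ≡.sym (component-padTake-[] r k)
spread-range (a ∷ as) zero    zero    k       = ≡.refl
spread-range (a ∷ as) zero    (suc r) zero    = ≡.trans (cong (a ++_) (spread-range-zero as 0 r)) (++-identityʳ a)
spread-range (a ∷ as) zero    (suc r) (suc k) = ≡.trans (spread-range-suc as 0 r k) (spread-range as 0 r k)
spread-range as       (suc n) r       zero    = spread-range-zero as n r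
spread-range as       (suc n) r       (suc k) = ≡.trans (spread-range-suc as n r k) (spread-range as n r k)

consˢ : ∀ {r} → MD → Snoc r → Snoc (suc r)
consˢ a ◇        = ◇ ▷ a
consˢ a (bs ▷ b) = consˢ a bs ▷ b

toListˢ-consˢ : ∀ {r} a (bs : Snoc r) → toListˢ (consˢ a bs) ≡ a ∷ toListˢ bs
toListˢ-consˢ a ◇        = ≡.refl
toListˢ-consˢ a (bs ▷ b) = cong (_++ b ∷ []) (toListˢ-consˢ a bs)

padded : (r : ℕ) → List MD → Snoc r
padded zero    _        = ◇
padded (suc r) []       = consˢ [] (padded r [])
padded (suc r) (a ∷ as) = consˢ a (padded r as)

toListˢ-padded : ∀ r as → toListˢ (padded r as) ≡ padTake r as
toListˢ-padded zero    _        = ≡.refl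
toListˢ-padded (suc r) []       = ≡.trans (toListˢ-consˢ [] (padded r [])) (cong ([] ∷_) (toListˢ-padded r []))
toListˢ-padded (suc r) (a ∷ as) = ≡.trans (toListˢ-consˢ a (padded r as)) (cong (a ∷_) (toListˢ-padded r as))

toList-⊕ : ∀ {n r} (ρ : Env n) (bs : Snoc r) → toList (ρ ⊕ bs) ≡ toList ρ ++ toListˢ bs
toList-⊕ ρ ◇        = ≡.sym (++-identityʳ (toList ρ))
toList-⊕ ρ (bs ▷ b) = begin
  toList ((ρ ⊕ bs) ∷ʳ b)             ≡⟨ toList-∷ʳ b (ρ ⊕ bs) ⟩
  toList (ρ ⊕ bs) ++ b ∷ []          ≡⟨ cong (_++ b ∷ []) (toList-⊕ ρ bs) ⟩
  (toList ρ ++ toListˢ bs) ++ b ∷ [] ≡⟨ ++-assoc (toList ρ) (toListˢ bs) (b ∷ []) ⟩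
  toList ρ ++ toListˢ bs ++ b ∷ []   ∎
  where open ≡.≡-Reasoning

assign-boundVars : ∀ as n r → assign as (boundVars n r) ≡ emptyE ⊕ padded r as
assign-boundVars as n r = at-injective _ _ λ k → begin
  at (assign as (boundVars n r)) k                   ≡⟨ at-assign as (boundVars n r) k ⟩
  spread as (map toℕ (boundVars n r)) k              ≡⟨ cong (λ js → spread as js k) (boundVars-range n r) ⟩
  spread as (range n r) k                            ≡⟨ spread-range as n r k ⟩
  component (List.replicate n [] ++ padTake r as) k  ≡⟨ cong (λ cs → component cs k) emptyE⊕padded ⟨
  at (emptyE ⊕ padded r as) k                        ∎
  where
  open ≡.≡-Reasoning
  emptyE⊕padded : toList (emptyE {n} ⊕ padded r as) ≡ List.replicate n [] ++ padTake r as
  emptyE⊕padded = ≡.trans (toList-⊕ emptyE (padded r as))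
                          (cong₂ _++_ (toList-replicate n []) (toListˢ-padded r as))

-- Trailing empty components

step≡0⇒ : ∀ a k → step a k ≡ 0 → a ≡ [] × k ≡ 0
step≡0⇒ []      zero    _  = ≡.refl , ≡.refl
step≡0⇒ (_ ∷ _) zero    ()
step≡0⇒ []      (suc _) ()
step≡0⇒ (_ ∷ _) (suc _) ()

lenS≡0⇒≈S[] : ∀ as → lenS as ≡ 0 → [] ≈S as
lenS≡0⇒≈S[] []       _  = []≈
lenS≡0⇒≈S[] (a ∷ as) eq with step≡0⇒ a (lenS as) eq
... | ≡.refl , eq′ = padʳ (lenS≡0⇒≈S[] as eq′)

take-lenS : ∀ as → take (lenS as) as ≈S as
take-lenS []       = []≈
take-lenS (a ∷ as) with lenS as in eq | take-lenS as
take-lenS ([] ∷ as)      | zero  | _  = padʳ (lenS≡0⇒≈S[] as eq)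
take-lenS ((_ ∷ _) ∷ as) | zero  | _  = ≈M-refl ∷≈ lenS≡0⇒≈S[] as eq
take-lenS ([] ∷ as)      | suc _ | ih = ≈M-refl ∷≈ ih
take-lenS ((_ ∷ _) ∷ as) | suc _ | ih = ≈M-refl ∷≈ ih

padTake-[] : ∀ r → padTake r [] ≈S []
padTake-[] zero    = []≈
padTake-[] (suc r) = padˡ (padTake-[] r)

padTake≈take : ∀ r as → padTake r as ≈S take r as
padTake≈take zero    _        = []≈
padTake≈take (suc r) []       = padˡ (padTake-[] r)
padTake≈take (suc r) (a ∷ as) = ≈M-refl ∷≈ padTake≈take r as

prefix-take-lenS : ∀ as → prefix (take (lenS as) as) ⋆ ≈D mk as
prefix-take-lenS as =
  subst (_≈D mk as) (≡.sym (≡.trans (prefix-mk _ []) (cong mk (++-identityʳ _)))) (mk≈ (take-lenS as))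

prefix-padded-lenS : ∀ as → prefix (toListˢ (padded (lenS as) as)) ⋆ ≈D mk as
prefix-padded-lenS as =
  subst (_≈D mk as) (≡.sym (≡.trans (prefix-mk _ []) (cong mk (≡.trans (++-identityʳ _) (toListˢ-padded _ as)))))
    (mk≈ (≈S-trans (padTake≈take (lenS as) as) (take-lenS as)))

mutual
  ⟦plus⟧ : ∀ α n {ρ : Env n} {β} → ⟦ plus α n ⟧ ρ β ⇔ (ρ ≈E emptyE × β ≈D α)
  ⟦plus⟧ (mk as) n {ρ} {β} = mk⇔ sound complete
    where
    r = lenS as
    xs = boundVars n r

    sound : ⟦ plus (mk as) n ⟧ ρ β → ρ ≈E emptyE × β ≈D mk as
    sound h with to (⟦lams⟧ r _) h
    ... | bs , γ , β≈ , γ≈⋆ , hV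
      with to (⊕-≈E bs (padded r as)) (subst (ρ ⊕ bs ≈E_) (assign-boundVars as n r) (to (⟦body⟧ as xs) hV))
    ... | ρ≈∅ , bs≋ = ρ≈∅ , ≈D-trans β≈ (≈D-trans (prefix-≋ bs≋ γ≈⋆) (prefix-padded-lenS as))

    complete : ρ ≈E emptyE × β ≈D mk as → ⟦ plus (mk as) n ⟧ ρ β
    complete (ρ≈∅ , β≈) = from (⟦lams⟧ r _)
      ( padded r as , ⋆ , ≈D-trans β≈ (≈D-sym (prefix-padded-lenS as)) , ≈D-refl
      , from (⟦body⟧ as xs) (subst (ρ ⊕ padded r as ≈E_) (≡.sym (assign-boundVars as n r))
                                   (from (⊕-≈E (padded r as) _) (ρ≈∅ , ≋-refl))))

  ⟦plusBag⟧ : ∀ a {m} {ρ : Env m} {b} → ⟦ plusBag a ⟧B ρ b ⇔ (ρ ≈E emptyE × b ≈M a)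
  ⟦plusBag⟧ []      = ⇔-id _
  ⟦plusBag⟧ (α ∷ a) = mk⇔
    (λ (ρ₁ , ρ₂ , β , b′ , e , b≈ , hα , ha) →
      let (ρ₁≈∅ , β≈α) = to (⟦plus⟧ α _) hα ; (ρ₂≈∅ , b′≈a) = to (⟦plusBag⟧ a) ha
      in ≈E-trans e (≈E-trans (⊎E-cong ρ₁≈∅ ρ₂≈∅) (⊎E-emptyʳ ≈E-refl)) , trans b≈ (prep β≈α b′≈a))
    (λ (ρ≈∅ , b≈) →
      _ , emptyE , α , a , ≈E-sym (⊎E-emptyʳ ≈E-refl) , b≈ ,
      from (⟦plus⟧ α _) (ρ≈∅ , ≈D-refl) , from (⟦plusBag⟧ a) (≈E-refl , ≈M-refl))

  ⟦app-plusBag⟧ : ∀ a {m} (M : Term m) {ρ δ} → ⟦ app M (plusBag a) ⟧ ρ δ ⇔ ⟦ M ⟧ ρ (a ∷D δ)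
  ⟦app-plusBag⟧ a M = mk⇔
    (λ (ρ₁ , ρ₂ , b , e , hM , hb) →
      let (ρ₂≈∅ , b≈a) = to (⟦plusBag⟧ a) hb
      in ⟦⟧-resp M (≈E-sym (≈E-trans e (⊎E-emptyʳ ρ₂≈∅))) (∷D-cong b≈a ≈D-refl) hM)
    (λ h → _ , emptyE , a , ≈E-sym (⊎E-emptyʳ ≈E-refl) , h , from (⟦plusBag⟧ a) (≈E-refl , ≈M-refl))

  ⟦apps⟧ : ∀ as k {m} (M : Term m) {ρ γ} → ⟦ apps M as k ⟧ ρ γ ⇔ ⟦ M ⟧ ρ (prefix (take k as) γ)
  ⟦apps⟧ []       zero    M = ⇔-id _
  ⟦apps⟧ []       (suc k) M = ⇔-id _
  ⟦apps⟧ (a ∷ as) zero    M = ⇔-id _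
  ⟦apps⟧ (a ∷ as) (suc k) M = ⇔-trans (⟦apps⟧ as k (app M (plusBag a))) (⟦app-plusBag⟧ a M)

  ⟦minus-var⟧ : ∀ α {m} (x : Fin m) {ρ} → ⟦ minus α (var x) ⟧T ρ ⇔ ρ ≈E unitE x α
  ⟦minus-var⟧ (mk as) x =
    ⇔-trans ⟦[ _ ]⟧T (⇔-trans (⟦apps⟧ as (lenS as) (var x)) (≈E-⇔ʳ (unitE-cong x (prefix-take-lenS as))))

  ⟦comp⟧ : ∀ a {m} (x : Fin m) {ρ} → ⟦ comp a x ⟧T ρ ⇔ ρ ≈E (emptyE [ x ]≔ a)
  ⟦comp⟧ []      x = ≈E-⇔ʳ (≈E-reflexive (≡.sym (emptyE-[]≔-[] x)))
  ⟦comp⟧ (α ∷ a) x =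
    ⇔-trans (⟦++⟧T-≈E (minus α (var x)) (comp a x) (⟦minus-var⟧ α x) (⟦comp⟧ a x))
            (≈E-⇔ʳ (≈E-reflexive (emptyE-[]≔-⊎E x (α ∷ []) a)))

  ⟦body⟧ : ∀ as {m} (xs : List (Fin m)) {ρ} → ⟦ body as xs ⟧T ρ ⇔ ρ ≈E assign as xs
  ⟦body⟧ []       xs       = ⇔-id _
  ⟦body⟧ (a ∷ as) []       = ⇔-id _
  ⟦body⟧ (a ∷ as) (x ∷ xs) = ⟦++⟧T-≈E (comp a x) (body as xs) (⟦comp⟧ a x) (⟦body⟧ as xs)

lemma5p4 : (α : D) →
    ((β : D) → ⟦ α ⁺ ⟧ [] β ⇔ β ≈D α) ×
    ((a : MD) → ⟦ α ⁻[x] ⟧T (a ∷ []) ⇔ a ≈M (α ∷ []))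
lemma5p4 α =
  (λ β → ⇔-trans (⟦plus⟧ α 0) (mk⇔ proj₂ (VecPw.[] ,_))) ,
  (λ a → ⇔-trans (⟦minus-var⟧ α fzero) (mk⇔ (λ { (a≈ VecPw.∷ VecPw.[]) → a≈ }) (VecPw._∷ VecPw.[])))
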